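{- Let $\omega$ be an $m$-restricted affine permutation and let $1\le i\le n$, $i<j$. Then (1) $\omega(i)<\omega(i+1)$ if and only if $\mathrm{SP}_\omega(i)\le\mathrm{SP}_\omega(i+1)$; (2) if $\omega(i)>\omega(j)$ then $\mathrm{SP}_\omega(i)>\mathrm{SP}_\omega(j)$.
   Context: Let $m,n$ be coprime. An affine permutation is a bijection $\omega:\mathbb{Z}\to\mathbb{Z}$ with $\omega(x+n)=\omega(x)+n$ and $\sum_{i=1}^n\omega(i)=\frac{n(n+1)}{2}$; it is $m$-restricted if $\omega(i)-\omega(j)\ne m$ for all $i<j$. For such $\omega$ and any $i\in\mathbb{Z}$ define $\mathrm{SP}_\omega(i)=\sharp\{j>i:\ 0<\omega(i)-\omega(j)<m\}$ (so $\mathrm{SP}_\omega(i+n)=\mathrm{SP}_\omega(i)$); $\mathrm{SP}_\omega$ equals $\mathrm{PS}_{\omega^{ -1}}$, where $\mathrm{PS}_\sigma(\alpha)=\sharp\{i:\sigma(i)>\alpha,\ \sigma^{ -1}(\alpha)-m<i<\sigma^{ -1}(\alpha)\}$. -}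

module Defs where

open import Data.Nat using (ℕ; zero; suc)
open import Data.Integer using (ℤ; +_; _+_; _-_; _*_; _<_; _≤_)
open import Data.Product using (_×_; Σ)
open import Data.List using (List; length)
open import Data.List.Membership.Propositional using (_∈_)
open import Data.List.Relation.Unary.Unique.Propositional using (Unique)
open import Function.Bundles using (_⇔_)
open import Function.Definitions using (Bijective)
open import Relation.Binary.PropositionalEquality using (_≡_; _≢_)

sumFrom1 : ℕ → (ℤ → ℤ) → ℤ
sumFrom1 zero    f = + 0
sumFrom1 (suc k) f = sumFrom1 k f + f (+ suc k)

record IsAffinePerm (n : ℕ) (ω : ℤ → ℤ) : Set where
  field
    bijective : Bijective _≡_ _≡_ ω
    periodic  : ∀ x → ω (x + + n) ≡ ω x + + n
    -- ∑_{i=1}^n ω(i) = n(n+1)/2, written as 2·∑ = n(n+1)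
    windowSum : + 2 * sumFrom1 n ω ≡ + n * + suc n

IsRestricted : ℕ → (ℤ → ℤ) → Set
IsRestricted m ω = ∀ i j → i < j → ω i - ω j ≢ + m

SPSet : ℕ → (ℤ → ℤ) → ℤ → ℤ → Set
SPSet m ω i j = (i < j) × ((+ 0 < ω i - ω j) × (ω i - ω j < + m))

SPIs : ℕ → (ℤ → ℤ) → ℤ → ℕ → Set
SPIs m ω i k =
  Σ (List ℤ) λ L → Unique L × (length L ≡ k) × (∀ j → (j ∈ L) ⇔ SPSet m ω i j)

-- For k counted by SP(l), raise ω(k) by a multiple of m into the window (ω(h) − m, ω(h)]
-- and call k′ the index with that value.  Because ω is m-restricted, ω-values differing by
-- a positive multiple of m occur in the same order as their positions, so k ≤ k′; hence k′
-- is counted by SP(h) as soon as ω(l) < ω(h) and every k counted by SP(l) lies right of h.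
-- The values ω(k) all lie in a window of width m below ω(l), so k ↦ k′ is injective and
-- SP(l) ≤ SP(h).  If moreover h < l, the index l itself is mapped too but is not counted by
-- SP(l), so SP(l) < SP(h).  Part (2) is the case (l, h) = (j, i); part (1) uses (i, i + 1)
-- and, for the converse, (i + 1, i).  For m = 0 coprimality forces n = 1, so ω is a
-- translation and SP vanishes.

module Submission where

open import Defs
open import Data.Nat using (ℕ)
open import Data.Nat.Coprimality using (Coprime)
open import Data.Integer using (ℤ; +_; _+_; _<_; _≤_; _>_)
open import Data.Product using (_×_)
open import Function.Bundles using (_⇔_)

import Data.Nat as ℕ
import Data.Nat.Properties as ℕₚ
open import Data.Nat.Divisibility using (_∣0; ∣-refl)
open import Data.Integer using (0ℤ; 1ℤ; -1ℤ; -_; _-_; _*_; _%ℕ_; _/ℕ_; +≤+; +<+; ∣_∣; nonNegative)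
import Data.Integer.Properties as ℤₚ
open import Data.Integer.DivMod using (a≡a%ℕn+[a/ℕn]*n; n%ℕd<d; 0≤n⇒0≤n/ℕd)
open import Data.Integer.Tactic.RingSolver using (solve-∀)
open import Data.Product using (_,_; proj₁; proj₂)
open import Data.Empty using (⊥-elim)
open import Data.List using (List; []; _∷_; length; removeAt)
open import Data.List.Properties using (length-removeAt′)
open import Data.List.Membership.Propositional using (_∈_)
open import Data.List.Relation.Unary.Any using (here; there; index)
import Data.List.Relation.Unary.All as All
open import Data.List.Relation.Unary.AllPairs using (_∷_)
open import Data.List.Relation.Unary.Unique.Propositional using (Unique)
open import Function using (_∘_)
open import Function.Bundles using (mk⇔; Equivalence)
open import Function.Definitions using (Bijective)
open import Relation.Binary using (tri<; tri≈; tri>)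
open import Relation.Binary.PropositionalEquality

module _ {a} {A : Set a} where

  ∈-removeAt : ∀ {x y : A} {ys} (x∈ys : x ∈ ys) → y ∈ ys → y ≢ x →
               y ∈ removeAt ys (index x∈ys)
  ∈-removeAt (here refl) (here refl)   y≢x = ⊥-elim (y≢x refl)
  ∈-removeAt (here _)    (there y∈ys)  _   = y∈ys
  ∈-removeAt (there _)   (here y≡z)    _   = here y≡z
  ∈-removeAt (there x∈ys) (there y∈ys) y≢x = there (∈-removeAt x∈ys y∈ys y≢x)

module _ {a b} {A : Set a} {B : Set b} where

  length-≤-injectiveOn : (f : A → B) {xs : List A} {ys : List B} → Unique xs →
    (∀ {x} → x ∈ xs → f x ∈ ys) →
    (∀ {x y} → x ∈ xs → y ∈ xs → f x ≡ f y → x ≡ y) →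
    length xs ℕ.≤ length ys
  length-≤-injectiveOn f {[]}     _                 _    _   = ℕ.z≤n
  length-≤-injectiveOn f {x ∷ xs} {ys} (x∉xs ∷ unique) into inj =
    subst (length (x ∷ xs) ℕ.≤_) (sym (length-removeAt′ ys (index fx∈ys)))
      (ℕ.s≤s (length-≤-injectiveOn f unique into′ (λ p q → inj (there p) (there q))))
    where
    fx∈ys : f x ∈ ys
    fx∈ys = into (here refl)
    into′ : ∀ {y} → y ∈ xs → f y ∈ removeAt ys (index fx∈ys)
    into′ y∈xs = ∈-removeAt fx∈ys (into (there y∈xs))
      (λ fy≡fx → All.lookup x∉xs y∈xs (sym (inj (there y∈xs) (here refl) fy≡fx)))

0<i-j⇒j<i : ∀ {i j} → 0ℤ < i - j → j < i
0<i-j⇒j<i {i} {j} 0<i-j = subst₂ _<_ (ℤₚ.+-identityʳ j) (j+[i-j]≡i j i) (ℤₚ.+-monoʳ-< j 0<i-j)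
  where
  j+[i-j]≡i : ∀ j i → j + (i - j) ≡ i
  j+[i-j]≡i = solve-∀

i<i+1 : ∀ i → i < i + 1ℤ
i<i+1 i = ℤₚ.suc[i]≤j⇒i<j (ℤₚ.≤-reflexive (ℤₚ.+-comm 1ℤ i))

module Window (m : ℕ) .{{_ : ℕ.NonZero m}} where

  record InWindow (c v : ℤ) : Set where
    constructor inWindow
    field
      gap-nonNeg : 0ℤ ≤ c - v
      gap<m      : c - v < + m

  InWindow-refl : ∀ c → InWindow c c
  InWindow-refl c =
    inWindow (ℤₚ.≤-reflexive (sym c-c≡0)) (subst (_< + m) (sym c-c≡0) (+<+ (ℕ.>-nonZero⁻¹ m)))
    where
    c-c≡0 : c - c ≡ 0ℤ
    c-c≡0 = ℤₚ.+-inverseʳ c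

  InWindow⇒-<m : ∀ {c v w} → InWindow c v → InWindow c w → v - w < + m
  InWindow⇒-<m {c} {v} {w} (inWindow 0≤c-v _) (inWindow _ c-w<m) = begin-strict
    v - w             ≡⟨ rearrange c v w ⟩
    (c - w) - (c - v) ≤⟨ ℤₚ.i-j≤i (c - w) (c - v) {{nonNegative 0≤c-v}} ⟩
    c - w             <⟨ c-w<m ⟩
    + m               ∎
    where
    open ℤₚ.≤-Reasoning
    rearrange : ∀ c v w → v - w ≡ (c - w) - (c - v)
    rearrange = solve-∀

  multiple-<m⇒0 : ∀ k → k * + m < + m → - (k * + m) < + m → k ≡ 0ℤ
  multiple-<m⇒0 k k*m<m -k*m<m =
    ℤₚ.≤-antisym (ℤₚ.i<j⇒i≤pred[j] k<1) (ℤₚ.i<j⇒suc[i]≤j -1<k)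
    where
    k<1 : k < 1ℤ
    k<1 = ℤₚ.*-cancelʳ-<-nonNeg (+ m)
      (subst (k * + m <_) (sym (ℤₚ.*-identityˡ (+ m))) k*m<m)
    -1<k : -1ℤ < k
    -1<k = ℤₚ.*-cancelʳ-<-nonNeg (+ m)
      (subst₂ _<_ (sym (ℤₚ.-1*i≡-i (+ m))) (ℤₚ.neg-involutive (k * + m)) (ℤₚ.neg-mono-< -k*m<m))

  -- the largest integer ≤ c that is congruent to v modulo m
  liftBelow : ℤ → ℤ → ℤ
  liftBelow c v = c - + ((c - v) %ℕ m)

  liftBelow-inWindow : ∀ c v → InWindow c (liftBelow c v)
  liftBelow-inWindow c v = inWindow
    (subst (0ℤ ≤_) (sym (c-[c-r]≡r c _)) (+≤+ ℕ.z≤n))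
    (subst (_< + m) (sym (c-[c-r]≡r c _)) (+<+ (n%ℕd<d (c - v) m)))
    where
    c-[c-r]≡r : ∀ c r → c - (c - r) ≡ r
    c-[c-r]≡r = solve-∀

  liftBelow≡+multiple : ∀ c v → liftBelow c v ≡ v + ((c - v) /ℕ m) * + m
  liftBelow≡+multiple c v = begin
    c - + r                          ≡⟨ move c v (+ r) ⟩
    v + ((c - v) - + r)              ≡⟨ cong (λ d → v + (d - + r)) (a≡a%ℕn+[a/ℕn]*n (c - v) m) ⟩
    v + ((+ r + q * + m) - + r)      ≡⟨ cancel v (+ r) (q * + m) ⟩
    v + q * + m                      ∎
    where
    open ≡-Reasoning
    r : ℕ
    r = (c - v) %ℕ m
    q : ℤ
    q = (c - v) /ℕ m
    move : ∀ c v r → c - r ≡ v + ((c - v) - r)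
    move = solve-∀
    cancel : ∀ v r x → v + ((r + x) - r) ≡ v + x
    cancel = solve-∀

  liftBelow-injectiveOn : ∀ {c d v w} → InWindow d v → InWindow d w →
                          liftBelow c v ≡ liftBelow c w → v ≡ w
  liftBelow-injectiveOn {c} {v = v} {w} v∈ w∈ eq = ℤₚ.i-j≡0⇒i≡j v w (begin
    v - w      ≡⟨ v-w≡k*m ⟩
    k * + m    ≡⟨ cong (_* + m) k≡0 ⟩
    0ℤ * + m   ≡⟨ ℤₚ.*-zeroˡ (+ m) ⟩
    0ℤ         ∎)
    where
    open ≡-Reasoning
    qv qw k : ℤ
    qv = (c - v) /ℕ m
    qw = (c - w) /ℕ m
    k = qw - qv
    v-w≡k*m : v - w ≡ k * + m
    v-w≡k*m = begin
      v - w                            ≡⟨ shift v w (qv * + m) ⟩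
      (v + qv * + m) - (w + qv * + m)  ≡⟨ cong (_- (w + qv * + m)) (trans (sym (liftBelow≡+multiple c v))
                                           (trans eq (liftBelow≡+multiple c w))) ⟩
      (w + qw * + m) - (w + qv * + m)  ≡⟨ collect w qw qv (+ m) ⟩
      k * + m                          ∎
      where
      shift : ∀ v w x → v - w ≡ (v + x) - (w + x)
      shift = solve-∀
      collect : ∀ w a b m → (w + a * m) - (w + b * m) ≡ (a - b) * m
      collect = solve-∀
    w-v≡-k*m : w - v ≡ - (k * + m)
    w-v≡-k*m = trans (negate w v) (cong -_ v-w≡k*m)
      where
      negate : ∀ w v → w - v ≡ - (v - w)
      negate = solve-∀
    k≡0 : k ≡ 0ℤ
    k≡0 = multiple-<m⇒0 k (subst (_< + m) v-w≡k*m (InWindow⇒-<m v∈ w∈))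
                          (subst (_< + m) w-v≡-k*m (InWindow⇒-<m w∈ v∈))

module Restricted {m : ℕ} .{{_ : ℕ.NonZero m}} {ω : ℤ → ℤ}
  (bijective : Bijective _≡_ _≡_ ω) (restricted : IsRestricted m ω) where

  open Window m

  ω-injective : ∀ {x y} → ω x ≡ ω y → x ≡ y
  ω-injective = proj₁ bijective

  ω⁻¹ : ℤ → ℤ
  ω⁻¹ y = proj₁ (proj₂ bijective y)

  ω∘ω⁻¹ : ∀ y → ω (ω⁻¹ y) ≡ y
  ω∘ω⁻¹ y = proj₂ (proj₂ bijective y) refl

  ω⁻¹-injective : ∀ {y z} → ω⁻¹ y ≡ ω⁻¹ z → y ≡ z
  ω⁻¹-injective {y} {z} eq = trans (sym (ω∘ω⁻¹ y)) (trans (cong ω eq) (ω∘ω⁻¹ z))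

  ω-+m⇒< : ∀ {x y} → ω x ≡ ω y + + m → y < x
  ω-+m⇒< {x} {y} eq = ℤₚ.≤∧≢⇒< (ℤₚ.≮⇒≥ (λ x<y → restricted x y x<y gap)) y≢x
    where
    cancel : ∀ a b → (a + b) - a ≡ b
    cancel = solve-∀
    gap : ω x - ω y ≡ + m
    gap = trans (cong (_- ω y) eq) (cancel (ω y) (+ m))
    y≢x : y ≢ x
    y≢x refl = ℕ.≢-nonZero⁻¹ m (ℤₚ.+-injective (trans (sym gap) (ℤₚ.+-inverseʳ (ω x))))

  ω-+multiple⇒≤ : ∀ t {x y} → ω x ≡ ω y + + t * + m → y ≤ x
  ω-+multiple⇒≤ ℕ.zero {x} {y} eq =
    ℤₚ.≤-reflexive (ω-injective (sym (trans eq (drop (ω y) (+ m)))))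
    where
    drop : ∀ a b → a + 0ℤ * b ≡ a
    drop = solve-∀
  ω-+multiple⇒≤ (ℕ.suc t) {x} {y} eq = ℤₚ.<⇒≤ (ℤₚ.<-≤-trans y<z (ω-+multiple⇒≤ t ωx≡ωz+tm))
    where
    z : ℤ
    z = ω⁻¹ (ω y + + m)
    y<z : y < z
    y<z = ω-+m⇒< (ω∘ω⁻¹ _)
    ωx≡ωz+tm : ω x ≡ ω z + + t * + m
    ωx≡ωz+tm = trans eq (trans (regroup (ω y) (+ t) (+ m)) (cong (_+ + t * + m) (sym (ω∘ω⁻¹ _))))
      where
      regroup : ∀ a t b → a + (1ℤ + t) * b ≡ (a + b) + t * b
      regroup = solve-∀

  shiftBelow : ℤ → ℤ → ℤ
  shiftBelow h k = ω⁻¹ (liftBelow (ω h) (ω k))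

  ≤-shiftBelow : ∀ {h k} → ω k ≤ ω h → k ≤ shiftBelow h k
  ≤-shiftBelow {h} {k} ωk≤ωh = ω-+multiple⇒≤ ∣ q ∣ (begin
    ω (shiftBelow h k)     ≡⟨ ω∘ω⁻¹ _ ⟩
    liftBelow (ω h) (ω k)  ≡⟨ liftBelow≡+multiple (ω h) (ω k) ⟩
    ω k + q * + m          ≡⟨ cong (λ t → ω k + t * + m) (sym (ℤₚ.0≤i⇒+∣i∣≡i 0≤q)) ⟩
    ω k + + ∣ q ∣ * + m    ∎)
    where
    open ≡-Reasoning
    q : ℤ
    q = (ω h - ω k) /ℕ m
    0≤q : 0ℤ ≤ q
    0≤q = 0≤n⇒0≤n/ℕd (ω h - ω k) m (ℤₚ.i≤j⇒0≤j-i ωk≤ωh)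

  shiftBelow∈SPSet : ∀ {h k} → ω k < ω h → h < k → SPSet m ω h (shiftBelow h k)
  shiftBelow∈SPSet {h} {k} ωk<ωh h<k = h<k′ , ℤₚ.≤∧≢⇒< 0≤gap gap≢0 , gap<m
    where
    k′ : ℤ
    k′ = shiftBelow h k
    h<k′ : h < k′
    h<k′ = ℤₚ.<-≤-trans h<k (≤-shiftBelow (ℤₚ.<⇒≤ ωk<ωh))
    k′∈window : InWindow (ω h) (ω k′)
    k′∈window = subst (InWindow (ω h)) (sym (ω∘ω⁻¹ _)) (liftBelow-inWindow (ω h) (ω k))
    open InWindow k′∈window renaming (gap-nonNeg to 0≤gap)
    gap≢0 : 0ℤ ≢ ω h - ω k′
    gap≢0 0≡gap = ℤₚ.<-irrefl (ω-injective (ℤₚ.i-j≡0⇒i≡j _ _ (sym 0≡gap))) h<k′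

  shiftBelow-injectiveOn : ∀ {c h k₁ k₂} → InWindow c (ω k₁) → InWindow c (ω k₂) →
                           shiftBelow h k₁ ≡ shiftBelow h k₂ → k₁ ≡ k₂
  shiftBelow-injectiveOn {h = h} k₁∈ k₂∈ eq =
    ω-injective (liftBelow-injectiveOn {ω h} k₁∈ k₂∈ (ω⁻¹-injective eq))

  Shiftable : ℤ → ℤ → ℤ → Set
  Shiftable c h k = ω k < ω h × h < k × InWindow c (ω k)

  length≤SP : ∀ {c h b} {ks : List ℤ} → Unique ks → (∀ {k} → k ∈ ks → Shiftable c h k) →
    SPIs m ω h b → length ks ℕ.≤ b
  length≤SP {c} {h} {ks = ks} unique below (L , _ , refl , SP↔) =
    length-≤-injectiveOn (shiftBelow h) unique into
      (λ k₁∈ks k₂∈ks → shiftBelow-injectiveOn (window k₁∈ks) (window k₂∈ks))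
    where
    window : ∀ {k} → k ∈ ks → InWindow c (ω k)
    window k∈ks = proj₂ (proj₂ (below k∈ks))
    into : ∀ {k} → k ∈ ks → shiftBelow h k ∈ L
    into k∈ks = Equivalence.from (SP↔ _)
      (shiftBelow∈SPSet (proj₁ (below k∈ks)) (proj₁ (proj₂ (below k∈ks))))

  SPSet⇒Shiftable : ∀ {l h k} → ω l < ω h → h < k → SPSet m ω l k → Shiftable (ω l) h k
  SPSet⇒Shiftable ωl<ωh h<k (_ , 0<gap , gap<m) =
    ℤₚ.<-trans (0<i-j⇒j<i 0<gap) ωl<ωh , h<k , inWindow (ℤₚ.<⇒≤ 0<gap) gap<m

  SP-mono : ∀ {l h a b} → ω l < ω h → (∀ {k} → SPSet m ω l k → h < k) →
            SPIs m ω l a → SPIs m ω h b → a ℕ.≤ b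
  SP-mono ωl<ωh beyond (_ , unique , refl , SP↔) = length≤SP unique λ k∈L →
    let k∈SP = Equivalence.to (SP↔ _) k∈L in SPSet⇒Shiftable ωl<ωh (beyond k∈SP) k∈SP

  SP-strictMono : ∀ {l h a b} → h < l → ω l < ω h →
                  SPIs m ω l a → SPIs m ω h b → a ℕ.< b
  SP-strictMono {l} {h} h<l ωl<ωh (L , unique , refl , SP↔) =
    length≤SP {ks = l ∷ L} (All.tabulate l≢ ∷ unique) below
    where
    inSP : ∀ {k} → k ∈ L → SPSet m ω l k
    inSP = Equivalence.to (SP↔ _)
    l≢ : ∀ {k} → k ∈ L → l ≢ k
    l≢ k∈L refl = ℤₚ.<-irrefl refl (proj₁ (inSP k∈L))
    below : ∀ {k} → k ∈ l ∷ L → Shiftable (ω l) h k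
    below (here refl)  = ωl<ωh , h<l , InWindow-refl (ω l)
    below (there k∈L) = SPSet⇒Shiftable ωl<ωh (ℤₚ.<-trans h<l (proj₁ (inSP k∈L))) (inSP k∈L)

  ascent⇔SP≤ : ∀ {i a b} → SPIs m ω i a → SPIs m ω (i + 1ℤ) b →
               (ω i < ω (i + 1ℤ)) ⇔ (a ℕ.≤ b)
  ascent⇔SP≤ {i} spᵢ spᵢ₊₁ =
    mk⇔ (λ ωi<ωi+1 → SP-mono ωi<ωi+1 (beyond ωi<ωi+1) spᵢ spᵢ₊₁) SP≤⇒ascent
    where
    beyond : ω i < ω (i + 1ℤ) → ∀ {k} → SPSet m ω i k → i + 1ℤ < k
    beyond ωi<ωi+1 {k} (i<k , 0<gap , _) =
      ℤₚ.≤∧≢⇒< (subst (_≤ k) (ℤₚ.+-comm 1ℤ i) (ℤₚ.i<j⇒suc[i]≤j i<k))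
        λ { refl → ℤₚ.<-asym (0<i-j⇒j<i 0<gap) ωi<ωi+1 }
    SP≤⇒ascent : _ ℕ.≤ _ → ω i < ω (i + 1ℤ)
    SP≤⇒ascent a≤b with ℤₚ.<-cmp (ω i) (ω (i + 1ℤ))
    ... | tri< ωi<ωi+1 _ _ = ωi<ωi+1
    ... | tri≈ _ ωi≡ωi+1 _ = ⊥-elim (ℤₚ.<-irrefl (ω-injective ωi≡ωi+1) (i<i+1 i))
    ... | tri> _ _ ωi+1<ωi = ⊥-elim (ℕₚ.<⇒≱ (SP-strictMono (i<i+1 i) ωi+1<ωi spᵢ₊₁ spᵢ) a≤b)

SPIs-zero : ∀ ω {i a} → SPIs 0 ω i a → a ≡ 0
SPIs-zero _ ([] , _ , refl , _) = refl
SPIs-zero _ (k ∷ _ , _ , _ , SP↔) with Equivalence.to (SP↔ k) (here refl)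
... | _ , 0<gap , gap<0 = ⊥-elim (ℤₚ.<-asym 0<gap gap<0)

module UnitShift {ω : ℤ → ℤ} (shift : ∀ x → ω (x + 1ℤ) ≡ ω x + 1ℤ) where

  ω[x+k]≡ω[x]+k : ∀ x k → ω (x + + k) ≡ ω x + + k
  ω[x+k]≡ω[x]+k x ℕ.zero = trans (cong ω (ℤₚ.+-identityʳ x)) (sym (ℤₚ.+-identityʳ (ω x)))
  ω[x+k]≡ω[x]+k x (ℕ.suc k) = begin
    ω (x + (1ℤ + + k))    ≡⟨ cong ω (regroup x (+ k)) ⟩
    ω ((x + + k) + 1ℤ)    ≡⟨ shift (x + + k) ⟩
    ω (x + + k) + 1ℤ      ≡⟨ cong (_+ 1ℤ) (ω[x+k]≡ω[x]+k x k) ⟩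
    (ω x + + k) + 1ℤ      ≡⟨ sym (regroup (ω x) (+ k)) ⟩
    ω x + (1ℤ + + k)      ∎
    where
    open ≡-Reasoning
    regroup : ∀ x k → x + (1ℤ + k) ≡ (x + k) + 1ℤ
    regroup = solve-∀

  ω-increasing : ∀ {i j} → i < j → ω i < ω j
  ω-increasing {i} {j} i<j = subst₂ _<_ (ℤₚ.+-identityʳ (ω i)) ωi+d≡ωj (ℤₚ.+-monoʳ-< (ω i) 0<d)
    where
    d : ℤ
    d = j - i
    0<d : 0ℤ < d
    0<d = subst (_< d) (ℤₚ.+-inverseʳ i) (ℤₚ.+-monoˡ-< (- i) i<j)
    i+d≡j : ∀ i j → i + (j - i) ≡ j
    i+d≡j = solve-∀
    ωi+d≡ωj : ω i + d ≡ ω j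
    ωi+d≡ωj = begin
      ω i + d             ≡⟨ cong (λ e → ω i + e) (sym (ℤₚ.0≤i⇒+∣i∣≡i (ℤₚ.<⇒≤ 0<d))) ⟩
      ω i + + ∣ d ∣        ≡⟨ sym (ω[x+k]≡ω[x]+k i ∣ d ∣) ⟩
      ω (i + + ∣ d ∣)      ≡⟨ cong (λ e → ω (i + e)) (ℤₚ.0≤i⇒+∣i∣≡i (ℤₚ.<⇒≤ 0<d)) ⟩
      ω (i + d)           ≡⟨ cong ω (i+d≡j i j) ⟩
      ω j                 ∎
      where open ≡-Reasoning

mainTheorem11 : (m n : ℕ) → Coprime m n → (ω : ℤ → ℤ) → IsAffinePerm n ω → IsRestricted m ω →
    (i j : ℤ) → + 1 ≤ i → i ≤ + n → i < j →
    ((a b : ℕ) → SPIs m ω i a → SPIs m ω (i + + 1) b →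
    (ω i < ω (i + + 1)) ⇔ (+ a ≤ + b))
    × (ω i > ω j → (a b : ℕ) → SPIs m ω i a → SPIs m ω j b → + a > + b)
mainTheorem11 ℕ.zero n coprime ω perm _ i j _ _ i<j =
    (λ a b spᵢ _ → mk⇔ (λ _ → +≤+ (subst (ℕ._≤ b) (sym (SPIs-zero ω spᵢ)) ℕ.z≤n))
                       (λ _ → ω-increasing (i<i+1 i)))
  , (λ ωj<ωi → ⊥-elim (ℤₚ.<-asym ωj<ωi (ω-increasing i<j)))
  where
  open UnitShift {ω} (subst (λ p → ∀ x → ω (x + + p) ≡ ω x + + p)
                        (coprime (n ∣0 , ∣-refl)) (IsAffinePerm.periodic perm))
mainTheorem11 (ℕ.suc _) n _ ω perm restricted i j _ _ i<j =
    (λ a b spᵢ spᵢ₊₁ → let open Equivalence (ascent⇔SP≤ spᵢ spᵢ₊₁)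
                       in mk⇔ (+≤+ ∘ to) (from ∘ ℤₚ.drop‿+≤+))
  , (λ ωj<ωi a b spᵢ spⱼ → +<+ (SP-strictMono i<j ωj<ωi spⱼ spᵢ))
  where
  open Restricted {ω = ω} (IsAffinePerm.bijective perm) restricted
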